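{- Let $\mathscr{C}$ be a weak hierarchy on a finite set $V$. If $\mathscr{C}$ satisfies (I), then $\mathscr{C}$ satisfies (WP), where (I): for all $A,B,C\in\mathscr{C}$ with $\emptyset\neq A\cap B\subseteq C$ and $C\setminus(A\cup B)\neq\emptyset$, we have $A\subseteq C$ or $B\subseteq C$; (WP): whenever $A,B,C\in\mathscr{C}$ have pairwise non-empty intersections, one of them is contained in the union of the other two.
   Context: A weak hierarchy is a set system $\mathscr{C}$ of non-empty subsets of $V$ such that for all $A,B,C\in\mathscr{C}$, $A\cap B\cap C\in\{A\cap B,A\cap C,B\cap C\}$. -}

module Defs where

open import Level using (Level; suc)
open import Data.Nat using (ℕ)
open import Data.Fin.Subset using (Subset; _∩_; _∪_; _─_; _⊆_; Nonempty)
open import Data.Sum using (_⊎_)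
open import Data.Product using (_×_)
open import Relation.Binary.PropositionalEquality using (_≡_)

-- A set system on the finite ground set V = Fin n is a predicate on subsets
-- (𝒞 X means X ∈ 𝒞).
SetSystem : (ℓ : Level) → ℕ → Set (suc ℓ)
SetSystem ℓ n = Subset n → Set ℓ

IsWeakHierarchy : ∀ {ℓ n} → SetSystem ℓ n → Set ℓ
IsWeakHierarchy {n = n} 𝒞 =
  (∀ A → 𝒞 A → Nonempty A) ×
  (∀ A B C → 𝒞 A → 𝒞 B → 𝒞 C →
     ((A ∩ B) ∩ C ≡ A ∩ B) ⊎ ((A ∩ B) ∩ C ≡ A ∩ C) ⊎ ((A ∩ B) ∩ C ≡ B ∩ C))

PropertyI : ∀ {ℓ n} → SetSystem ℓ n → Set ℓ
PropertyI 𝒞 =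
  ∀ A B C → 𝒞 A → 𝒞 B → 𝒞 C →
    Nonempty (A ∩ B) → (A ∩ B) ⊆ C → Nonempty (C ─ (A ∪ B)) →
    (A ⊆ C) ⊎ (B ⊆ C)

PropertyWP : ∀ {ℓ n} → SetSystem ℓ n → Set ℓ
PropertyWP 𝒞 =
  ∀ A B C → 𝒞 A → 𝒞 B → 𝒞 C →
    Nonempty (A ∩ B) → Nonempty (A ∩ C) → Nonempty (B ∩ C) →
    (A ⊆ (B ∪ C)) ⊎ (B ⊆ (A ∪ C)) ⊎ (C ⊆ (A ∪ B))

{-# OPTIONS --safe #-}
module Submission where

-- In a weak hierarchy every triple A, B, C has a pairwise intersection
-- contained in the third set, say A ∩ B ⊆ C.  Either C ⊆ A ∪ B, or C has a
-- point outside A ∪ B, and then (I) puts A or B inside C, so that one of them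
-- is covered by the other two.  The remaining cases are permutations.

open import Defs
open import Level using (Level)
open import Data.Nat using (ℕ)
open import Data.Fin.Subset using (Subset; _∩_; _∪_; _─_; _⊆_; Nonempty)
open import Data.Fin.Subset.Properties
  using (_∈?_; nonempty?; x∈p∧x∉q⇒x∈p─q; p∩q⊆p; p∩q⊆q; q⊆p∪q; ∪-comm; ⊆-trans; ⊆-reflexive)
open import Data.Sum using (_⊎_; inj₁; inj₂)
open import Data.Product using (_,_)
open import Relation.Nullary using (yes; no)
open import Relation.Nullary.Decidable using (decidable-stable)
open import Relation.Binary.PropositionalEquality using (_≡_; sym; subst)

⊆⊎Nonempty─ : ∀ {n} (p q : Subset n) → p ⊆ q ⊎ Nonempty (p ─ q)
⊆⊎Nonempty─ p q with nonempty? (p ─ q)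
... | yes p─q≠∅ = inj₂ p─q≠∅
... | no  p─q=∅ = inj₁ λ {x} x∈p →
  decidable-stable (x ∈? q) λ x∉q → p─q=∅ (x , x∈p∧x∉q⇒x∈p─q x∈p x∉q)

⊆-∪-comm : ∀ {n} {r p q : Subset n} → r ⊆ p ∪ q → r ⊆ q ∪ p
⊆-∪-comm {r = r} {p} {q} = subst (r ⊆_) (∪-comm p q)

OneCoveredByOthers : ∀ {n} → Subset n → Subset n → Subset n → Set
OneCoveredByOthers A B C = (A ⊆ (B ∪ C)) ⊎ (B ⊆ (A ∪ C)) ⊎ (C ⊆ (A ∪ B))

oneCoveredByOthers-swap₁₂ : ∀ {n} {A B C : Subset n} →
  OneCoveredByOthers A B C → OneCoveredByOthers B A C
oneCoveredByOthers-swap₁₂ (inj₁ A⊆B∪C)        = inj₂ (inj₁ A⊆B∪C)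
oneCoveredByOthers-swap₁₂ (inj₂ (inj₁ B⊆A∪C)) = inj₁ B⊆A∪C
oneCoveredByOthers-swap₁₂ (inj₂ (inj₂ C⊆A∪B)) = inj₂ (inj₂ (⊆-∪-comm C⊆A∪B))

oneCoveredByOthers-swap₂₃ : ∀ {n} {A B C : Subset n} →
  OneCoveredByOthers A B C → OneCoveredByOthers A C B
oneCoveredByOthers-swap₂₃ (inj₁ A⊆B∪C)        = inj₁ (⊆-∪-comm A⊆B∪C)
oneCoveredByOthers-swap₂₃ (inj₂ (inj₁ B⊆A∪C)) = inj₂ (inj₂ B⊆A∪C)
oneCoveredByOthers-swap₂₃ (inj₂ (inj₂ C⊆A∪B)) = inj₂ (inj₁ C⊆A∪B)

intersection⊆third : ∀ {n} (A B C : Subset n) →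
  ((A ∩ B) ∩ C ≡ A ∩ B) ⊎ ((A ∩ B) ∩ C ≡ A ∩ C) ⊎ ((A ∩ B) ∩ C ≡ B ∩ C) →
  (A ∩ B ⊆ C) ⊎ (A ∩ C ⊆ B) ⊎ (B ∩ C ⊆ A)
intersection⊆third A B C (inj₁ e) =
  inj₁ (⊆-trans (⊆-reflexive (sym e)) (p∩q⊆q (A ∩ B) C))
intersection⊆third A B C (inj₂ (inj₁ e)) =
  inj₂ (inj₁ (⊆-trans (⊆-reflexive (sym e)) (⊆-trans (p∩q⊆p (A ∩ B) C) (p∩q⊆q A B))))
intersection⊆third A B C (inj₂ (inj₂ e)) =
  inj₂ (inj₂ (⊆-trans (⊆-reflexive (sym e)) (⊆-trans (p∩q⊆p (A ∩ B) C) (p∩q⊆p A B))))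

propertyI⇒oneCoveredByOthers : ∀ {ℓ n} {𝒞 : SetSystem ℓ n} → PropertyI 𝒞 →
  ∀ {A B C} → 𝒞 A → 𝒞 B → 𝒞 C → Nonempty (A ∩ B) → A ∩ B ⊆ C →
  OneCoveredByOthers A B C
propertyI⇒oneCoveredByOthers I {A} {B} {C} 𝒞A 𝒞B 𝒞C A∩B≠∅ A∩B⊆C
  with ⊆⊎Nonempty─ C (A ∪ B)
... | inj₁ C⊆A∪B = inj₂ (inj₂ C⊆A∪B)
... | inj₂ C─A∪B≠∅ with I A B C 𝒞A 𝒞B 𝒞C A∩B≠∅ A∩B⊆C C─A∪B≠∅
...   | inj₁ A⊆C = inj₁ (⊆-trans A⊆C (q⊆p∪q B C))
...   | inj₂ B⊆C = inj₂ (inj₁ (⊆-trans B⊆C (q⊆p∪q A C)))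

mainTheorem8 : ∀ {ℓ : Level} (n : ℕ) (𝒞 : SetSystem ℓ n) →
    IsWeakHierarchy 𝒞 → PropertyI 𝒞 → PropertyWP 𝒞
mainTheorem8 n 𝒞 (_ , weak) I A B C 𝒞A 𝒞B 𝒞C A∩B≠∅ A∩C≠∅ B∩C≠∅
  with intersection⊆third A B C (weak A B C 𝒞A 𝒞B 𝒞C)
... | inj₁ A∩B⊆C =
  propertyI⇒oneCoveredByOthers I 𝒞A 𝒞B 𝒞C A∩B≠∅ A∩B⊆C
... | inj₂ (inj₁ A∩C⊆B) = oneCoveredByOthers-swap₂₃
  (propertyI⇒oneCoveredByOthers I 𝒞A 𝒞C 𝒞B A∩C≠∅ A∩C⊆B)
... | inj₂ (inj₂ B∩C⊆A) = oneCoveredByOthers-swap₁₂ (oneCoveredByOthers-swap₂₃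
  (propertyI⇒oneCoveredByOthers I 𝒞B 𝒞C 𝒞A B∩C≠∅ B∩C⊆A))
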